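{- Let $m=2$ and $k=3$. For any $U>0$ there exists a matrix $A\in\mathbb{R}^{m\times k}_{\ge0}$ such that the $A$-knapsack polytope $\mathcal{B}=\{x\in\Delta_k:Ax\le\mathbf{1}\}$ satisfies $\mathrm{Lip}(\mathcal{B})\ge U$.
   Context: $\Delta_k=\{x\in\mathbb{R}^k_{\ge0}:\|x\|_1=1\}$. For convex $\mathcal{B}\subseteq\Delta_k$: $\sigma:[n]\times[k]\to\mathbb{R}_{\ge0}$ satisfies $\sigma\sim(\mathcal{B},h)$ if $\sum_p\sigma(p,\cdot)=h$ and $\sigma(p,\cdot)\in\|\sigma(p,\cdot)\|_1\mathcal{B}$ for all $p$. For $h,h'\in\mathcal{B}$ and $\sigma\sim(\mathcal{B},h)$ with $\|\sigma\|_1=1$, $\mathrm{OAT}(\mathcal{B},h,h',\sigma)=\min\|\sigma-\sigma'\|_1$ over $\sigma'\sim(\mathcal{B},h')$ with $\|\sigma'(p,\cdot)\|_1=\|\sigma(p,\cdot)\|_1$ for all $p$, and $\mathrm{Lip}(\mathcal{B})=\max\mathrm{OAT}(\mathcal{B},h,h',\sigma)/\|h-h'\|_1$ over all such $h\ne h'$, $\sigma$, $n$.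
   Formalization: U ranges over the positive rationals, the competing σ′ in OAT have only rational entries, and the witnesses A, h, h′, σ are taken with rational entries. -}

module Defs where

open import Data.Nat using (ℕ; zero; suc)
open import Data.Fin using (Fin; zero; suc)
open import Data.Rational using (ℚ; 0ℚ; 1ℚ; _+_; _-_; _*_; ∣_∣; _≤_)
open import Data.Product using (Σ; _×_; ∃)
open import Relation.Binary.PropositionalEquality using (_≡_)
open import Relation.Nullary using (¬_)

sumFin : ∀ {n} → (Fin n → ℚ) → ℚ
sumFin {zero}  f = 0ℚ
sumFin {suc n} f = f zero + sumFin (λ i → f (suc i))

Vecℚ : ℕ → Set
Vecℚ k = Fin k → ℚ

Region : ℕ → Set₁
Region k = Vecℚ k → Set

norm1 : ∀ {k} → Vecℚ k → ℚ
norm1 x = sumFin (λ i → ∣ x i ∣)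

dist1 : ∀ {k} → Vecℚ k → Vecℚ k → ℚ
dist1 x y = norm1 (λ i → x i - y i)

Assign : ℕ → ℕ → Set
Assign n k = Fin n → Fin k → ℚ

normMat : ∀ {n k} → Assign n k → ℚ
normMat σ = sumFin (λ p → norm1 (σ p))

distMat : ∀ {n k} → Assign n k → Assign n k → ℚ
distMat σ τ = sumFin (λ p → dist1 (σ p) (τ p))

Simplex : ∀ {k} → Region k
Simplex x = (∀ i → 0ℚ ≤ x i) × (sumFin x ≡ 1ℚ)

Knapsack : ∀ {m k} → (Fin m → Fin k → ℚ) → Region k
Knapsack A x = Simplex x × (∀ j → sumFin (λ i → A j i * x i) ≤ 1ℚ)

InScaled : ∀ {k} → Region k → Vecℚ k → Set
InScaled B v = Σ (Vecℚ _) (λ x → B x × (∀ i → v i ≡ norm1 v * x i))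

Consistent : ∀ {n k} → Region k → Vecℚ k → Assign n k → Set
Consistent B h σ =
  (∀ p i → 0ℚ ≤ σ p i) ×
  (∀ i → sumFin (λ p → σ p i) ≡ h i) ×
  (∀ p → InScaled B (σ p))

-- Lip(B) ≥ U, unfolded: some instance (n, h ≠ h', σ) has OAT(B,h,h',σ) ≥ U ‖h - h'‖₁,
-- i.e. every admissible σ' is at distance ≥ U ‖h - h'‖₁ from σ.
LipAtLeast : ∀ {k} → Region k → ℚ → Set
LipAtLeast {k} B U =
  Σ ℕ λ n → Σ (Vecℚ k) λ h → Σ (Vecℚ k) λ h' → Σ (Assign n k) λ σ →
    B h × B h' × ¬ (h ≡ h') × Consistent B h σ × normMat σ ≡ 1ℚ ×
    ((σ' : Assign n k) → Consistent B h' σ' →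
       (∀ p → norm1 (σ' p) ≡ norm1 (σ p)) →
       U * dist1 h h' ≤ distMat σ σ')

{-# OPTIONS --safe #-}
-- Under the single knapsack row (1 + δ) x₀ + (1 − δ) x₁ ≤ 1, a type supported on
-- items 0 and 1 must have x₀ ≤ x₁, i.e. x₁ ≥ ½. Two players of weight ½ with types
-- (0, 1, 0) and (1 − δ, 0, δ) give the load h = ½ (1 − δ, 1, δ). The load
-- h′ = (½, ½, 0) is at distance δ but carries nothing on item 2, so in any σ′ for h′
-- the second player's type lives on items 0 and 1 and puts mass ≥ ¼ on item 1, where
-- it had none. Hence OAT ≥ ¼ = ‖h − h′‖₁ / (4δ), and δ → 0 makes Lip unbounded.
module Submission where

open import Defs
open import Data.Fin using (Fin)
open import Data.Rational using (ℚ; 0ℚ; _≤_; _<_)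
open import Data.Product using (Σ; _×_)

open import Data.Fin using (suc)
open import Data.Nat using (zero; suc)
open import Data.Fin.Patterns using (0F; 1F; 2F)
open import Data.List using (_∷_; [])
open import Data.Product using (_,_; proj₁)
open import Data.Rational
  using (1ℚ; ½; _+_; _-_; _*_; -_; ∣_∣; 1/_; Positive; NonZero; positive; nonNegative)
open import Data.Rational.Properties
open import Function using (_∘_)
open import Level using (0ℓ)
open import Relation.Binary.PropositionalEquality
open import Relation.Nullary.Decidable using (from-yes; dec⇒maybe)
open import Tactic.RingSolver using (solve-∀; solve)
open import Tactic.RingSolver.Core.AlmostCommutativeRing
  using (AlmostCommutativeRing; fromCommutativeRing)

ℚ-ring : AlmostCommutativeRing 0ℓ 0ℓ
ℚ-ring = fromCommutativeRing +-*-commutativeRing (λ x → dec⇒maybe (0ℚ ≟ x))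

p≤q⇒0≤q-p : ∀ {p q} → p ≤ q → 0ℚ ≤ q - p
p≤q⇒0≤q-p {p} {q} p≤q = begin
  0ℚ    ≡⟨ sym (+-inverseʳ p) ⟩
  p - p ≤⟨ +-monoˡ-≤ (- p) p≤q ⟩
  q - p ∎
  where open ≤-Reasoning

slack⇒≤ : ∀ {p q s} → 0ℚ ≤ s → p + s ≡ q → p ≤ q
slack⇒≤ {p} {q} {s} 0≤s p+s≡q = begin
  p      ≡⟨ sym (+-identityʳ p) ⟩
  p + 0ℚ ≤⟨ +-monoʳ-≤ p 0≤s ⟩
  p + s  ≡⟨ p+s≡q ⟩
  q      ∎
  where open ≤-Reasoning

∣0-p∣≡p : ∀ {p} → 0ℚ ≤ p → ∣ 0ℚ - p ∣ ≡ p
∣0-p∣≡p {p} 0≤p = trans (cong ∣_∣ (+-identityˡ (- p))) (trans (∣-p∣≡∣p∣ p) (0≤p⇒∣p∣≡p 0≤p))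

0≤p*q : ∀ {p q} → 0ℚ ≤ p → 0ℚ ≤ q → 0ℚ ≤ p * q
0≤p*q {p} {q} 0≤p 0≤q =
  nonNegative⁻¹ (p * q) {{nonNeg*nonNeg⇒nonNeg p {{nonNegative 0≤p}} q {{nonNegative 0≤q}}}}

sumFin-cong : ∀ {n} {f g : Fin n → ℚ} → (∀ i → f i ≡ g i) → sumFin f ≡ sumFin g
sumFin-cong {zero} f≡g = refl
sumFin-cong {suc n} f≡g = cong₂ _+_ (f≡g 0F) (sumFin-cong (f≡g ∘ suc))

sumFin-*ˡ : ∀ {n} c (f : Fin n → ℚ) → sumFin (λ i → c * f i) ≡ c * sumFin f
sumFin-*ˡ {zero}  c f = sym (*-zeroʳ c)
sumFin-*ˡ {suc n} c f = begin
  c * f 0F + sumFin (λ i → c * f (suc i)) ≡⟨ cong (c * f 0F +_) (sumFin-*ˡ c (f ∘ suc)) ⟩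
  c * f 0F + c * sumFin (f ∘ suc)          ≡⟨ sym (*-distribˡ-+ c (f 0F) _) ⟩
  c * sumFin f                             ∎
  where open ≡-Reasoning

sumFin-nonNeg : ∀ {n} {f : Fin n → ℚ} → (∀ i → 0ℚ ≤ f i) → 0ℚ ≤ sumFin f
sumFin-nonNeg {zero}  0≤f = ≤-refl
sumFin-nonNeg {suc n} 0≤f = +-mono-≤ (0≤f 0F) (sumFin-nonNeg (0≤f ∘ suc))

term≤sumFin : ∀ {n} {f : Fin n → ℚ} → (∀ i → 0ℚ ≤ f i) → ∀ i → f i ≤ sumFin f
term≤sumFin {suc n} 0≤f 0F = slack⇒≤ (sumFin-nonNeg (0≤f ∘ suc)) refl
term≤sumFin {suc n} {f} 0≤f (suc i) = begin
  f (suc i)               ≤⟨ term≤sumFin (0≤f ∘ suc) i ⟩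
  sumFin (f ∘ suc)        ≤⟨ slack⇒≤ (0≤f 0F) (+-comm _ (f 0F)) ⟩
  f 0F + sumFin (f ∘ suc) ∎
  where open ≤-Reasoning

nonNeg-sumFin≡0⇒≡0 : ∀ {n} {f : Fin n → ℚ} → (∀ i → 0ℚ ≤ f i) → sumFin f ≡ 0ℚ →
                     ∀ i → f i ≡ 0ℚ
nonNeg-sumFin≡0⇒≡0 0≤f Σf≡0 i =
  ≤-antisym (≤-trans (term≤sumFin 0≤f i) (≤-reflexive Σf≡0)) (0≤f i)

norm1-nonNeg : ∀ {k} {x : Vecℚ k} → (∀ i → 0ℚ ≤ x i) → norm1 x ≡ sumFin x
norm1-nonNeg 0≤x = sumFin-cong (λ i → 0≤p⇒∣p∣≡p (0≤x i))

norm1-*ˡ : ∀ {k c} (x : Vecℚ k) → 0ℚ ≤ c → norm1 (λ i → c * x i) ≡ c * norm1 x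
norm1-*ˡ {c = c} x 0≤c = trans (sumFin-cong ∣c*xᵢ∣≡c*∣xᵢ∣) (sumFin-*ˡ c (λ i → ∣ x i ∣))
  where
  ∣c*xᵢ∣≡c*∣xᵢ∣ : ∀ i → ∣ c * x i ∣ ≡ c * ∣ x i ∣
  ∣c*xᵢ∣≡c*∣xᵢ∣ i = trans (∣p*q∣≡∣p∣*∣q∣ c (x i)) (cong (_* ∣ x i ∣) (0≤p⇒∣p∣≡p 0≤c))

norm1-*-simplex : ∀ {k c} {x : Vecℚ k} → 0ℚ ≤ c → Simplex x → norm1 (λ i → c * x i) ≡ c
norm1-*-simplex {c = c} {x} 0≤c (0≤x , Σx≡1) = begin
  norm1 (λ i → c * x i) ≡⟨ norm1-*ˡ x 0≤c ⟩
  c * norm1 x           ≡⟨ cong (c *_) (trans (norm1-nonNeg 0≤x) Σx≡1) ⟩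
  c * 1ℚ                ≡⟨ *-identityʳ c ⟩
  c                     ∎
  where open ≡-Reasoning

InScaled-*ˡ : ∀ {k c} {B : Region k} {x : Vecℚ k} → 0ℚ ≤ c → B x → Simplex x →
              InScaled B (λ i → c * x i)
InScaled-*ˡ {x = x} 0≤c x∈B x∈Δ =
  x , x∈B , λ i → cong (_* x i) (sym (norm1-*-simplex 0≤c x∈Δ))

∣σ-τ∣≤distMat : ∀ {n k} (σ τ : Assign n k) p i → ∣ σ p i - τ p i ∣ ≤ distMat σ τ
∣σ-τ∣≤distMat σ τ p i = ≤-trans
  (term≤sumFin (λ j → 0≤∣p∣ (σ p j - τ p j)) i)
  (term≤sumFin (λ q → sumFin-nonNeg (λ j → 0≤∣p∣ (σ q j - τ q j))) p)

vec₃ : ℚ → ℚ → ℚ → Vecℚ 3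
vec₃ a b c 0F = a
vec₃ a b c 1F = b
vec₃ a b c 2F = c

-- The second row is zero: it only pads A to the required two rows.
tilt : ℚ → Fin 2 → Fin 3 → ℚ
tilt δ 0F = vec₃ (1ℚ + δ) (1ℚ - δ) 0ℚ
tilt δ 1F _ = 0ℚ

tilt-nonNeg : ∀ {δ} → 0ℚ ≤ δ → δ ≤ 1ℚ → ∀ j i → 0ℚ ≤ tilt δ j i
tilt-nonNeg 0≤δ δ≤1 0F 0F = +-mono-≤ (nonNegative⁻¹ 1ℚ) 0≤δ
tilt-nonNeg 0≤δ δ≤1 0F 1F = p≤q⇒0≤q-p δ≤1
tilt-nonNeg 0≤δ δ≤1 0F 2F = ≤-refl
tilt-nonNeg 0≤δ δ≤1 1F _  = ≤-refl

tilt-load : ∀ δ (x : Vecℚ 3) →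
            sumFin (λ i → tilt δ 0F i * x i) ≡ (1ℚ + δ) * x 0F + (1ℚ - δ) * x 1F
tilt-load δ x = drop-item₂ ((1ℚ + δ) * x 0F) ((1ℚ - δ) * x 1F) (x 2F)
  where
  drop-item₂ : ∀ a b c → a + (b + (0ℚ * c + 0ℚ)) ≡ a + b
  drop-item₂ = solve-∀ ℚ-ring

vec₃∈Knapsack-tilt : ∀ δ a b c → 0ℚ ≤ a → 0ℚ ≤ b → 0ℚ ≤ c → a + (b + c) ≡ 1ℚ →
                     (1ℚ + δ) * a + (1ℚ - δ) * b ≤ 1ℚ → Knapsack (tilt δ) (vec₃ a b c)
vec₃∈Knapsack-tilt δ a b c 0≤a 0≤b 0≤c a+b+c≡1 row =
  ( (λ { 0F → 0≤a ; 1F → 0≤b ; 2F → 0≤c })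
  , trans (cong (λ t → a + (b + t)) (+-identityʳ c)) a+b+c≡1 )
  , λ { 0F → ≤-trans (≤-reflexive (tilt-load δ (vec₃ a b c))) row
      ; 1F → ≤-trans (≤-reflexive (zero-row a b c)) (nonNegative⁻¹ 1ℚ)
      }
  where
  zero-row : ∀ a b c → 0ℚ * a + (0ℚ * b + (0ℚ * c + 0ℚ)) ≡ 0ℚ
  zero-row = solve-∀ ℚ-ring

tilted-row⇒½≤x₁ : ∀ {δ x₀ x₁} → 0ℚ < δ → x₀ + x₁ ≡ 1ℚ →
                  (1ℚ + δ) * x₀ + (1ℚ - δ) * x₁ ≤ 1ℚ → ½ ≤ x₁
tilted-row⇒½≤x₁ {δ} {x₀} {x₁} 0<δ x₀+x₁≡1 row = begin
  ½             ≡⟨ sym (*-identityʳ ½) ⟩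
  ½ * 1ℚ        ≡⟨ cong (½ *_) (sym x₀+x₁≡1) ⟩
  ½ * (x₀ + x₁) ≤⟨ *-monoˡ-≤-nonNeg ½ (+-monoˡ-≤ x₁ x₀≤x₁) ⟩
  ½ * (x₁ + x₁) ≡⟨ solve (x₁ ∷ []) ℚ-ring ⟩
  x₁            ∎
  where
  open ≤-Reasoning
  -- The row load is (x₀ + x₁) + δ (x₀ − x₁) = 1 + δ (x₀ − x₁).
  x₀≤x₁ : x₀ ≤ x₁
  x₀≤x₁ = *-cancelˡ-≤-pos δ {{positive 0<δ}} (begin
    δ * x₀
      ≡⟨ solve (δ ∷ x₀ ∷ x₁ ∷ []) ℚ-ring ⟩
    (1ℚ + δ) * x₀ + (1ℚ - δ) * x₁ + (δ * x₁ - (x₀ + x₁))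
      ≤⟨ +-monoˡ-≤ _ row ⟩
    1ℚ + (δ * x₁ - (x₀ + x₁))
      ≡⟨ cong (λ s → 1ℚ + (δ * x₁ - s)) x₀+x₁≡1 ⟩
    1ℚ + (δ * x₁ - 1ℚ)
      ≡⟨ solve (δ ∷ x₁ ∷ []) ℚ-ring ⟩
    δ * x₁ ∎)

Knapsack-tilt⇒½≤x₁ : ∀ {δ} {x : Vecℚ 3} → 0ℚ < δ → Knapsack (tilt δ) x → x 2F ≡ 0ℚ →
                     ½ ≤ x 1F
Knapsack-tilt⇒½≤x₁ {δ} {x} 0<δ ((_ , Σx≡1) , rows) x₂≡0 =
  tilted-row⇒½≤x₁ 0<δ x₀+x₁≡1 (≤-trans (≤-reflexive (sym (tilt-load δ x))) (rows 0F))
  where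
  open ≡-Reasoning
  x₀+x₁≡1 : x 0F + x 1F ≡ 1ℚ
  x₀+x₁≡1 = begin
    x 0F + x 1F                   ≡⟨ cong (x 0F +_) (sym (+-identityʳ (x 1F))) ⟩
    x 0F + (x 1F + (0ℚ + 0ℚ))     ≡⟨ cong (λ c → x 0F + (x 1F + (c + 0ℚ))) (sym x₂≡0) ⟩
    sumFin x                      ≡⟨ Σx≡1 ⟩
    1ℚ                            ∎

module TiltInstance {δ : ℚ} (0<δ : 0ℚ < δ) (δ≤1 : δ ≤ 1ℚ) where

  0≤δ : 0ℚ ≤ δ
  0≤δ = <⇒≤ 0<δ

  0≤½ : 0ℚ ≤ ½
  0≤½ = nonNegative⁻¹ ½

  B : Region 3
  B = Knapsack (tilt δ)

  type : Fin 2 → Vecℚ 3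
  type 0F = vec₃ 0ℚ 1ℚ 0ℚ
  type 1F = vec₃ (1ℚ - δ) 0ℚ δ

  σ : Assign 2 3
  σ p i = ½ * type p i

  h h′ : Vecℚ 3
  h  = vec₃ (½ * (1ℚ - δ)) ½ (½ * δ)
  h′ = vec₃ ½ ½ 0ℚ

  type∈B : ∀ p → B (type p)
  type∈B 0F = vec₃∈Knapsack-tilt δ 0ℚ 1ℚ 0ℚ ≤-refl (nonNegative⁻¹ 1ℚ) ≤-refl refl
    (slack⇒≤ 0≤δ (solve (δ ∷ []) ℚ-ring))
  type∈B 1F = vec₃∈Knapsack-tilt δ (1ℚ - δ) 0ℚ δ (p≤q⇒0≤q-p δ≤1) ≤-refl 0≤δ
    (solve (δ ∷ []) ℚ-ring)
    (slack⇒≤ (0≤p*q 0≤δ 0≤δ) (solve (δ ∷ []) ℚ-ring))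

  h∈B : B h
  h∈B = vec₃∈Knapsack-tilt δ (½ * (1ℚ - δ)) ½ (½ * δ)
    (0≤p*q 0≤½ (p≤q⇒0≤q-p δ≤1)) 0≤½ (0≤p*q 0≤½ 0≤δ)
    (solve (δ ∷ []) ℚ-ring)
    (slack⇒≤ (0≤p*q 0≤½ (+-mono-≤ 0≤δ (0≤p*q 0≤δ 0≤δ))) (solve (δ ∷ []) ℚ-ring))

  h′∈B : B h′
  h′∈B = vec₃∈Knapsack-tilt δ ½ ½ 0ℚ 0≤½ 0≤½ ≤-refl refl (≤-reflexive (solve (δ ∷ []) ℚ-ring))

  type∈Δ : ∀ p → Simplex (type p)
  type∈Δ p = proj₁ (type∈B p)

  σ-consistent : Consistent B h σ
  σ-consistent = (λ p i → 0≤p*q 0≤½ (proj₁ (type∈Δ p) i)) , load , scaled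
    where
    load : ∀ i → sumFin (λ p → σ p i) ≡ h i
    load 0F = trans (+-identityˡ _) (+-identityʳ _)
    load 1F = refl
    load 2F = trans (+-identityˡ _) (+-identityʳ _)
    scaled : ∀ p → InScaled B (σ p)
    scaled p = InScaled-*ˡ 0≤½ (type∈B p) (type∈Δ p)

  norm1-σ : ∀ p → norm1 (σ p) ≡ ½
  norm1-σ p = norm1-*-simplex 0≤½ (type∈Δ p)

  normMat-σ : normMat σ ≡ 1ℚ
  normMat-σ = cong₂ (λ a b → a + (b + 0ℚ)) (norm1-σ 0F) (norm1-σ 1F)

  h≢h′ : h ≢ h′
  h≢h′ h≡h′ = <-irrefl (sym (cong (λ v → v 2F) h≡h′)) 0<½δ
    where
    0<½δ : 0ℚ < ½ * δ
    0<½δ = positive⁻¹ (½ * δ) {{pos*pos⇒pos ½ δ {{positive 0<δ}}}}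

  dist1-h-h′ : dist1 h h′ ≡ δ
  dist1-h-h′ = begin
    ∣ ½ * (1ℚ - δ) - ½ ∣ + (∣ ½ - ½ ∣ + (∣ ½ * δ - 0ℚ ∣ + 0ℚ))
      ≡⟨ cong₂ (λ a b → ∣ a ∣ + (0ℚ + (∣ b ∣ + 0ℚ))) h₀-h′₀ h₂-h′₂ ⟩
    ∣ - (½ * δ) ∣ + (0ℚ + (∣ ½ * δ ∣ + 0ℚ))
      ≡⟨ cong (_+ (0ℚ + (∣ ½ * δ ∣ + 0ℚ))) (∣-p∣≡∣p∣ (½ * δ)) ⟩
    ∣ ½ * δ ∣ + (0ℚ + (∣ ½ * δ ∣ + 0ℚ))
      ≡⟨ cong (λ a → a + (0ℚ + (a + 0ℚ))) (0≤p⇒∣p∣≡p (0≤p*q 0≤½ 0≤δ)) ⟩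
    ½ * δ + (0ℚ + (½ * δ + 0ℚ))
      ≡⟨ solve (δ ∷ []) ℚ-ring ⟩
    δ ∎
    where
    open ≡-Reasoning
    h₀-h′₀ : ½ * (1ℚ - δ) - ½ ≡ - (½ * δ)
    h₀-h′₀ = solve (δ ∷ []) ℚ-ring
    h₂-h′₂ : ½ * δ - 0ℚ ≡ ½ * δ
    h₂-h′₂ = solve (δ ∷ []) ℚ-ring

  ¼≤distMat : ∀ σ′ → Consistent B h′ σ′ → norm1 (σ′ 1F) ≡ ½ → ½ * ½ ≤ distMat σ σ′
  ¼≤distMat σ′ (0≤σ′ , load′ , scaled′) norm1-σ′₁ with scaled′ 1F
  ... | x , x∈B , σ′₁≡‖σ′₁‖x = begin
    ½ * ½                  ≤⟨ *-monoˡ-≤-nonNeg ½ (Knapsack-tilt⇒½≤x₁ 0<δ x∈B x₂≡0) ⟩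
    ½ * x 1F               ≡⟨ sym (σ′₁≡½x 1F) ⟩
    σ′ 1F 1F               ≡⟨ sym (∣0-p∣≡p (0≤σ′ 1F 1F)) ⟩
    ∣ σ 1F 1F - σ′ 1F 1F ∣ ≤⟨ ∣σ-τ∣≤distMat σ σ′ 1F 1F ⟩
    distMat σ σ′           ∎
    where
    open ≤-Reasoning
    σ′₁≡½x : ∀ i → σ′ 1F i ≡ ½ * x i
    σ′₁≡½x i = trans (σ′₁≡‖σ′₁‖x i) (cong (_* x i) norm1-σ′₁)
    halves : ∀ y → y ≡ ½ * y + ½ * y
    halves = solve-∀ ℚ-ring
    ½x₂≡0 : ½ * x 2F ≡ 0ℚ
    ½x₂≡0 = trans (sym (σ′₁≡½x 2F)) (nonNeg-sumFin≡0⇒≡0 (λ p → 0≤σ′ p 2F) (load′ 2F) 1F)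
    x₂≡0 : x 2F ≡ 0ℚ
    x₂≡0 = trans (halves (x 2F)) (cong (λ t → t + t) ½x₂≡0)

  LipAtLeast-tilt : ∀ U → U * δ ≤ ½ * ½ → LipAtLeast B U
  LipAtLeast-tilt U Uδ≤¼ = 2 , h , h′ , σ , h∈B , h′∈B , h≢h′ , σ-consistent , normMat-σ , OAT≥
    where
    OAT≥ : ∀ σ′ → Consistent B h′ σ′ → (∀ p → norm1 (σ′ p) ≡ norm1 (σ p)) →
           U * dist1 h h′ ≤ distMat σ σ′
    OAT≥ σ′ σ′∼h′ same-norms = begin
      U * dist1 h h′ ≡⟨ cong (U *_) dist1-h-h′ ⟩
      U * δ          ≤⟨ Uδ≤¼ ⟩
      ½ * ½          ≤⟨ ¼≤distMat σ′ σ′∼h′ (trans (same-norms 1F) (norm1-σ 1F)) ⟩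
      distMat σ σ′   ∎
      where open ≤-Reasoning

small-tilt : ∀ {U} → 0ℚ < U → Σ ℚ λ δ → 0ℚ < δ × δ ≤ 1ℚ × U * δ ≤ ½ * ½
small-tilt {U} 0<U = δ , 0<δ , δ≤1 , slack⇒≤ 0≤δ Uδ+δ≡¼
  where
  instance
    U+1>0 : Positive (U + 1ℚ)
    U+1>0 = pos+pos⇒pos U {{positive 0<U}} 1ℚ
    U+1≢0 : NonZero (U + 1ℚ)
    U+1≢0 = pos⇒nonZero (U + 1ℚ)
  r δ : ℚ
  r = 1/ (U + 1ℚ)
  δ = ½ * ½ * r
  0<δ : 0ℚ < δ
  0<δ = positive⁻¹ δ {{pos*pos⇒pos (½ * ½) r {{1/pos⇒pos (U + 1ℚ)}}}}
  0≤δ : 0ℚ ≤ δ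
  0≤δ = <⇒≤ 0<δ
  factor : ∀ U r → U * (½ * ½ * r) + ½ * ½ * r ≡ ½ * ½ * ((U + 1ℚ) * r)
  factor = solve-∀ ℚ-ring
  Uδ+δ≡¼ : U * δ + δ ≡ ½ * ½
  Uδ+δ≡¼ = trans (factor U r) (cong (½ * ½ *_) (*-inverseʳ (U + 1ℚ)))
  δ≤1 : δ ≤ 1ℚ
  δ≤1 = ≤-trans (slack⇒≤ (0≤p*q (<⇒≤ 0<U) 0≤δ) (trans (+-comm δ (U * δ)) Uδ+δ≡¼))
                (from-yes (½ * ½ ≤? 1ℚ))

theorem5p16 : (U : ℚ) → 0ℚ < U →
    Σ (Fin 2 → Fin 3 → ℚ) λ A → (∀ j i → 0ℚ ≤ A j i) × LipAtLeast (Knapsack A) U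
theorem5p16 U 0<U =
  let δ , 0<δ , δ≤1 , Uδ≤¼ = small-tilt 0<U
  in tilt δ , tilt-nonNeg (<⇒≤ 0<δ) δ≤1 , TiltInstance.LipAtLeast-tilt 0<δ δ≤1 U Uδ≤¼
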